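{- For every CoS context $\xi\{\ \}$ and CoS formulae $\alpha$ and $\beta$, there is a $\mathsf{Frege}$ derivation with premiss $\alpha\to\beta$ and conclusion $\xi\{\alpha\}\to\xi\{\beta\}$ whose length is $O(m)$ and whose size is $O(n^2)$, where $m=|\xi\{\ \}|$ and $n=|\xi\{\alpha\}\to\xi\{\beta\}|$.
   Context: CoS formulae are built from units $\mathsf f,\mathsf t$, atoms $a,\bar a,\dots$, formula variables $A,\bar A,\dots$ by $[\alpha\vee\beta]$ and $(\alpha\wedge\beta)$; the De Morgan dual $\bar\alpha$ exchanges $\vee/\wedge$, $\mathsf t/\mathsf f$ and negates atoms and variables. The size $|\alpha|$ is the number of occurrences of units, atoms and variables. A context $\xi\{\ \}$ is a formula with one hole in place of a subformula, $\xi\{\alpha\}$ is the result of filling the hole with $\alpha$, and $|\xi\{\ \}|=|\xi\{a\}|-1$. $\mathsf{Frege}$: formulae over $\mathsf t,\mathsf f$, non-negated variables, $\vee,\wedge,\to,\neg$; axiom schemes $F_1: A\to(B\to(A\wedge B))$; $F_2:(A\wedge B)\to A$; $F_3:(A\wedge B)\to B$; $F_4:A\to(A\vee B)$; $F_5:B\to(A\vee B)$; $F_6:\neg\neg A\to A$; $F_7:A\to\neg\neg A$; $F_8:A\to(B\to A)$; $F_9:\neg A\to(A\to B)$; $F_{10}:(A\to(B\to C))\to((A\to B)\to(A\to C))$; $F_{11}:(A\to C)\to((B\to C)\to((A\vee B)\to C))$; $F_{12}:(A\to(B\to C))\to(B\to(A\to C))$; $F_{13}:(A\to B)\to(\neg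 B\to\neg A)$; $F_{14}:\mathsf f\to(A\wedge\neg A)$; $F_{15}:(A\wedge\neg A)\to\mathsf f$; $F_{16}:\mathsf t\to(A\vee\neg A)$; $F_{17}:(A\vee\neg A)\to\mathsf t$ (instances by substituting formulae), and modus ponens. A Frege derivation with given premisses is a sequence of formulae each of which is a premiss, an axiom instance, or follows by modus ponens from earlier ones; its length is the number of formulae and its size the number of occurrences of units and variables. Translation: CoS formulae are read as Frege formulae with atoms/variables as Frege variables, negated atoms/variables as $\neg$ of variables; a Frege $\alpha\to\beta$ corresponds to $[\bar\alpha\vee\beta]$. -}

module Defs where

open import Data.Nat using (ℕ; suc; _+_; _∸_)
open import Data.Sum using (_⊎_; inj₁; inj₂)
open import Data.Product using (Σ; _×_)
open import Data.List using (List; []; _∷_; _++_; [_]; map)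
open import Data.Nat.ListAction using (sum)
open import Data.List.Membership.Propositional using (_∈_)

-- CoS formulae
-- Atoms and formula variables are both named by natural numbers;
-- a negated atom/variable is a single leaf (size 1).

data CoS : Set where
  𝕗 𝕥   : CoS
  atom  : ℕ → CoS
  natom : ℕ → CoS
  var   : ℕ → CoS
  nvar  : ℕ → CoS
  _∨_   : CoS → CoS → CoS
  _∧_   : CoS → CoS → CoS

dual : CoS → CoS
dual 𝕗 = 𝕥
dual 𝕥 = 𝕗
dual (atom a) = natom a
dual (natom a) = atom a
dual (var a) = nvar a
dual (nvar a) = var a
dual (α ∨ β) = dual α ∧ dual β
dual (α ∧ β) = dual α ∨ dual β

∣_∣ : CoS → ℕ
∣ α ∨ β ∣ = ∣ α ∣ + ∣ β ∣
∣ α ∧ β ∣ = ∣ α ∣ + ∣ β ∣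
∣ _ ∣ = 1

data Ctx : Set where
  hole : Ctx
  _∨ₗ_ : Ctx → CoS → Ctx
  _∨ᵣ_ : CoS → Ctx → Ctx
  _∧ₗ_ : Ctx → CoS → Ctx
  _∧ᵣ_ : CoS → Ctx → Ctx

_⟦_⟧ : Ctx → CoS → CoS
hole     ⟦ α ⟧ = α
(ξ ∨ₗ β) ⟦ α ⟧ = (ξ ⟦ α ⟧) ∨ β
(β ∨ᵣ ξ) ⟦ α ⟧ = β ∨ (ξ ⟦ α ⟧)
(ξ ∧ₗ β) ⟦ α ⟧ = (ξ ⟦ α ⟧) ∧ β
(β ∧ᵣ ξ) ⟦ α ⟧ = β ∧ (ξ ⟦ α ⟧)

∣_∣ᶜ : Ctx → ℕ
∣ ξ ∣ᶜ = ∣ ξ ⟦ atom 0 ⟧ ∣ ∸ 1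

-- Frege formulae over t, f, non-negated variables, ∨, ∧, →, ¬.
-- Frege variables are named by  ℕ ⊎ ℕ : inj₁ a for the CoS atom a,
-- inj₂ A for the CoS formula variable A.

Name : Set
Name = ℕ ⊎ ℕ

data Fm : Set where
  ⊤f ⊥f : Fm
  v     : Name → Fm
  _⋁_   : Fm → Fm → Fm
  _⋀_   : Fm → Fm → Fm
  _⇒_   : Fm → Fm → Fm
  ¬f    : Fm → Fm

infixr 4 _⇒_

size : Fm → ℕ
size ⊤f = 1
size ⊥f = 1
size (v x) = 1
size (A ⋁ B) = size A + size B
size (A ⋀ B) = size A + size B
size (A ⇒ B) = size A + size B
size (¬f A) = size A

data Axiom : Fm → Set where
  F1  : ∀ A B → Axiom (A ⇒ (B ⇒ (A ⋀ B)))
  F2  : ∀ A B → Axiom ((A ⋀ B) ⇒ A)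
  F3  : ∀ A B → Axiom ((A ⋀ B) ⇒ B)
  F4  : ∀ A B → Axiom (A ⇒ (A ⋁ B))
  F5  : ∀ A B → Axiom (B ⇒ (A ⋁ B))
  F6  : ∀ A → Axiom (¬f (¬f A) ⇒ A)
  F7  : ∀ A → Axiom (A ⇒ ¬f (¬f A))
  F8  : ∀ A B → Axiom (A ⇒ (B ⇒ A))
  F9  : ∀ A B → Axiom (¬f A ⇒ (A ⇒ B))
  F10 : ∀ A B C → Axiom ((A ⇒ (B ⇒ C)) ⇒ ((A ⇒ B) ⇒ (A ⇒ C)))
  F11 : ∀ A B C → Axiom ((A ⇒ C) ⇒ ((B ⇒ C) ⇒ ((A ⋁ B) ⇒ C)))
  F12 : ∀ A B C → Axiom ((A ⇒ (B ⇒ C)) ⇒ (B ⇒ (A ⇒ C)))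
  F13 : ∀ A B → Axiom ((A ⇒ B) ⇒ (¬f B ⇒ ¬f A))
  F14 : ∀ A → Axiom (⊥f ⇒ (A ⋀ ¬f A))
  F15 : ∀ A → Axiom ((A ⋀ ¬f A) ⇒ ⊥f)
  F16 : ∀ A → Axiom (⊤f ⇒ (A ⋁ ¬f A))
  F17 : ∀ A → Axiom ((A ⋁ ¬f A) ⇒ ⊤f)

Justified : List Fm → List Fm → Fm → Set
Justified Γ ds φ =
  (φ ∈ Γ) ⊎ (Axiom φ ⊎ Σ Fm (λ ψ → (ψ ∈ ds) × ((ψ ⇒ φ) ∈ ds)))

data IsDerivation (Γ : List Fm) : List Fm → Set where
  []  : IsDerivation Γ []
  _▷_ : ∀ {ds φ} → IsDerivation Γ ds → Justified Γ ds φ →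
        IsDerivation Γ (ds ++ [ φ ])

dsize : List Fm → ℕ
dsize ds = sum (map size ds)

tr : CoS → Fm
tr 𝕗 = ⊥f
tr 𝕥 = ⊤f
tr (atom a) = v (inj₁ a)
tr (natom a) = ¬f (v (inj₁ a))
tr (var a) = v (inj₂ a)
tr (nvar a) = ¬f (v (inj₂ a))
tr (α ∨ β) = tr α ⋁ tr β
tr (α ∧ β) = tr α ⋀ tr β

module Submission where

open import Defs
open import Data.Nat using (ℕ; suc; _*_; _≤_; _+_; _<_; _≤?_; z≤n; s≤s; >-nonZero)
open import Data.Nat.Properties
open import Data.Product using (Σ; _×_; _,_; proj₁; proj₂)
open import Data.List using (List; length; _++_; [_]; []; _∷_; map)
open import Data.List.Properties using (length-++; length-map; ++-assoc; ++-identityʳ)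
open import Data.Sum using (inj₁; inj₂)
open import Data.List.Membership.Propositional using (_∈_)
open import Data.List.Membership.Propositional.Properties using (∈-++⁺ˡ; ∈-++⁺ʳ)
open import Data.List.Relation.Unary.Any using (here)
open import Data.List.Relation.Unary.All using (All; []; _∷_; all?)
open import Data.List.Relation.Unary.All.Properties using (++⁺)
import Data.List.Relation.Unary.All as All
open import Relation.Nullary using (Dec)
open import Relation.Nullary.Decidable using (toWitness; _×-dec_)
open import Relation.Binary.PropositionalEquality using (_≡_; refl; sym; trans; cong; cong₂; subst)
open import Data.Nat.Tactic.RingSolver using (solve-∀)

-- A context ξ{ } is processed one connective at a time,
-- innermost first.  Each connective is a *frame* X ↦ X ∨ C, C ∨ X, X ∧ C or
-- C ∧ X, and for each frame a fixed Frege script of at most 15 formulae turns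
-- a derived X → Y into a derived frame(X) → frame(Y).  Every formula of such a
-- script is an instance of a *template* with at most 16 placeholders filled by
-- X, Y and C, so its size is at most 16 times the size of the new implication.
--   Each frame's side formula C contributes at least one symbol to ξ{a}, so
-- the whole derivation has at most 16·|ξ{a}| = 16(m+1) formulae; implication
-- sizes only grow, so each formula has size at most 16n, and the total size
-- is at most 16(m+1)·16n ≤ 256n² (as m+1 ≤ n).

infixl 5 _⊳_ _⊳⊳_

_⊳_ : List Fm → Fm → List Fm
ds ⊳ φ = ds ++ [ φ ]

_⊳⊳_ : List Fm → List Fm → List Fm
ds ⊳⊳ []       = ds
ds ⊳⊳ (φ ∷ fs) = (ds ⊳ φ) ⊳⊳ fs

⊳⊳-is-++ : ∀ ds fs → ds ⊳⊳ fs ≡ ds ++ fs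
⊳⊳-is-++ ds []       = sym (++-identityʳ ds)
⊳⊳-is-++ ds (φ ∷ fs) = trans (⊳⊳-is-++ (ds ⊳ φ) fs) (++-assoc ds [ φ ] fs)

length-⊳⊳ : ∀ ds fs → length (ds ⊳⊳ fs) ≡ length ds + length fs
length-⊳⊳ ds fs = trans (cong length (⊳⊳-is-++ ds fs)) (length-++ ds)

All-⊳⊳ : ∀ {P : Fm → Set} {ds fs} → All P ds → All P fs → All P (ds ⊳⊳ fs)
All-⊳⊳ {P} {ds} {fs} pds pfs = subst (All P) (sym (⊳⊳-is-++ ds fs)) (++⁺ pds pfs)

All-⊳ : ∀ {P : Fm → Set} {ds φ} → All P ds → P φ → All P (ds ⊳ φ)
All-⊳ pds pφ = ++⁺ pds (pφ ∷ [])

new : ∀ {ds φ} → φ ∈ ds ⊳ φ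
new {ds} = ∈-++⁺ʳ ds (here refl)

wk : ∀ {ds φ ψ} → ψ ∈ ds → ψ ∈ ds ⊳ φ
wk = ∈-++⁺ˡ

wks : ∀ {ds ψ} fs → ψ ∈ ds → ψ ∈ ds ⊳⊳ fs
wks []       p = p
wks (φ ∷ fs) p = wks fs (wk p)

data Template : Set where
  𝐱 𝐲 𝐜          : Template
  _⋁ᵗ_ _⋀ᵗ_ _⇒ᵗ_ : Template → Template → Template

infixr 4 _⇒ᵗ_
infixr 6 _⋁ᵗ_ _⋀ᵗ_

⟪_⟫ : Template → Fm → Fm → Fm → Fm
⟪ 𝐱 ⟫      X Y C = X
⟪ 𝐲 ⟫      X Y C = Y
⟪ 𝐜 ⟫      X Y C = C
⟪ s ⋁ᵗ t ⟫ X Y C = ⟪ s ⟫ X Y C ⋁ ⟪ t ⟫ X Y C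
⟪ s ⋀ᵗ t ⟫ X Y C = ⟪ s ⟫ X Y C ⋀ ⟪ t ⟫ X Y C
⟪ s ⇒ᵗ t ⟫ X Y C = ⟪ s ⟫ X Y C ⇒ ⟪ t ⟫ X Y C

inst : List Template → Fm → Fm → Fm → List Fm
inst ts X Y C = map (λ t → ⟪ t ⟫ X Y C) ts

leaves : Template → ℕ
leaves (s ⋁ᵗ t) = leaves s + leaves t
leaves (s ⋀ᵗ t) = leaves s + leaves t
leaves (s ⇒ᵗ t) = leaves s + leaves t
leaves _        = 1

+-bound : ∀ {a b} k l M → a ≤ k * M → b ≤ l * M → a + b ≤ (k + l) * M
+-bound k l M p q = ≤-trans (+-mono-≤ p q) (≤-reflexive (sym (*-distribʳ-+ M k l)))

size-⟪⟫ : ∀ t {X Y C M} → size X ≤ M → size Y ≤ M → size C ≤ M →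
          size (⟪ t ⟫ X Y C) ≤ leaves t * M
size-⟪⟫ 𝐱 {M = M} hx hy hc = ≤-trans hx (≤-reflexive (sym (+-identityʳ M)))
size-⟪⟫ 𝐲 {M = M} hx hy hc = ≤-trans hy (≤-reflexive (sym (+-identityʳ M)))
size-⟪⟫ 𝐜 {M = M} hx hy hc = ≤-trans hc (≤-reflexive (sym (+-identityʳ M)))
size-⟪⟫ (s ⋁ᵗ t) {M = M} hx hy hc =
  +-bound (leaves s) (leaves t) M (size-⟪⟫ s hx hy hc) (size-⟪⟫ t hx hy hc)
size-⟪⟫ (s ⋀ᵗ t) {M = M} hx hy hc =
  +-bound (leaves s) (leaves t) M (size-⟪⟫ s hx hy hc) (size-⟪⟫ t hx hy hc)
size-⟪⟫ (s ⇒ᵗ t) {M = M} hx hy hc =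
  +-bound (leaves s) (leaves t) M (size-⟪⟫ s hx hy hc) (size-⟪⟫ t hx hy hc)

size-inst : ∀ {k} ts {X Y C M} → All (λ t → leaves t ≤ k) ts →
            size X ≤ M → size Y ≤ M → size C ≤ M →
            All (λ φ → size φ ≤ k * M) (inst ts X Y C)
size-inst []       []       hx hy hc = []
size-inst (t ∷ ts) (l ∷ ls) hx hy hc =
  ≤-trans (size-⟪⟫ t hx hy hc) (*-monoˡ-≤ _ l) ∷ size-inst ts ls hx hy hc

module _ {Γ : List Fm} where

  axiom : ∀ {ds φ} → IsDerivation Γ ds → Axiom φ → IsDerivation Γ (ds ⊳ φ)
  axiom d a = d ▷ inj₂ (inj₁ a)

  modusPonens : ∀ {ds ψ φ} → IsDerivation Γ ds → ψ ∈ ds → (ψ ⇒ φ) ∈ ds →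
                IsDerivation Γ (ds ⊳ φ)
  modusPonens {ψ = ψ} d p q = d ▷ inj₂ (inj₂ (ψ , p , q))

-- Hypothetical syllogism P→Q, Q→R ⊢ P→R via F8 and F10; its last formula is P → R.
syllogism : Template → Template → Template → List Template
syllogism p q r =
  ((q ⇒ᵗ r) ⇒ᵗ (p ⇒ᵗ (q ⇒ᵗ r))) ∷ (p ⇒ᵗ (q ⇒ᵗ r)) ∷
  ((p ⇒ᵗ (q ⇒ᵗ r)) ⇒ᵗ ((p ⇒ᵗ q) ⇒ᵗ (p ⇒ᵗ r))) ∷ ((p ⇒ᵗ q) ⇒ᵗ (p ⇒ᵗ r)) ∷ (p ⇒ᵗ r) ∷ []

module _ {Γ : List Fm} where

  syllogismRule : ∀ {ds} P Q R → IsDerivation Γ ds → (P ⇒ Q) ∈ ds → (Q ⇒ R) ∈ ds →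
                  IsDerivation Γ (ds ⊳⊳ inst (syllogism 𝐱 𝐲 𝐜) P Q R)
  syllogismRule P Q R d p⇒q q⇒r =
    let d₁ = axiom d (F8 (Q ⇒ R) P)
        d₂ = modusPonens d₁ (wk q⇒r) new                  -- P → (Q → R)
        d₃ = axiom d₂ (F10 P Q R)
        d₄ = modusPonens d₃ (wk new) new                  -- (P → Q) → (P → R)
    in  modusPonens d₄ (wk (wk (wk (wk p⇒q)))) new

data Frame : Set where
  ∨-left ∨-right ∧-left ∧-right : Frame

wrap : Frame → Fm → Fm → Fm
wrap ∨-left  C X = X ⋁ C
wrap ∨-right C X = C ⋁ X
wrap ∧-left  C X = X ⋀ C
wrap ∧-right C X = C ⋀ X

wrap-grows : ∀ f C X → size X ≤ size (wrap f C X) × size C ≤ size (wrap f C X)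
wrap-grows ∨-left  C X = m≤m+n (size X) (size C) , m≤n+m (size C) (size X)
wrap-grows ∨-right C X = m≤n+m (size X) (size C) , m≤m+n (size C) (size X)
wrap-grows ∧-left  C X = m≤m+n (size X) (size C) , m≤n+m (size C) (size X)
wrap-grows ∧-right C X = m≤n+m (size X) (size C) , m≤m+n (size C) (size X)

-- The intermediate formulae of the Frege derivation of
-- wrap f C X → wrap f C Y from X → Y, as templates (𝐱 = X, 𝐲 = Y, 𝐜 = C).
script : Frame → List Template
script ∨-left =                        -- Y → Y∨C,  X → Y∨C,  C → Y∨C,  F11
  (𝐲 ⇒ᵗ 𝐲 ⋁ᵗ 𝐜) ∷ syllogism 𝐱 𝐲 (𝐲 ⋁ᵗ 𝐜) ++
  (𝐜 ⇒ᵗ 𝐲 ⋁ᵗ 𝐜) ∷ ((𝐱 ⇒ᵗ 𝐲 ⋁ᵗ 𝐜) ⇒ᵗ ((𝐜 ⇒ᵗ 𝐲 ⋁ᵗ 𝐜) ⇒ᵗ (𝐱 ⋁ᵗ 𝐜 ⇒ᵗ 𝐲 ⋁ᵗ 𝐜))) ∷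
  ((𝐜 ⇒ᵗ 𝐲 ⋁ᵗ 𝐜) ⇒ᵗ (𝐱 ⋁ᵗ 𝐜 ⇒ᵗ 𝐲 ⋁ᵗ 𝐜)) ∷ []
script ∨-right =                       -- Y → C∨Y,  X → C∨Y,  C → C∨Y,  F11
  (𝐲 ⇒ᵗ 𝐜 ⋁ᵗ 𝐲) ∷ syllogism 𝐱 𝐲 (𝐜 ⋁ᵗ 𝐲) ++
  (𝐜 ⇒ᵗ 𝐜 ⋁ᵗ 𝐲) ∷ ((𝐜 ⇒ᵗ 𝐜 ⋁ᵗ 𝐲) ⇒ᵗ ((𝐱 ⇒ᵗ 𝐜 ⋁ᵗ 𝐲) ⇒ᵗ (𝐜 ⋁ᵗ 𝐱 ⇒ᵗ 𝐜 ⋁ᵗ 𝐲))) ∷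
  ((𝐱 ⇒ᵗ 𝐜 ⋁ᵗ 𝐲) ⇒ᵗ (𝐜 ⋁ᵗ 𝐱 ⇒ᵗ 𝐜 ⋁ᵗ 𝐲)) ∷ []
script ∧-left =                        -- X∧C → Y,  X∧C → (C → Y∧C),  F10,  X∧C → C
  (𝐱 ⋀ᵗ 𝐜 ⇒ᵗ 𝐱) ∷ syllogism (𝐱 ⋀ᵗ 𝐜) 𝐱 𝐲 ++
  (𝐲 ⇒ᵗ (𝐜 ⇒ᵗ 𝐲 ⋀ᵗ 𝐜)) ∷ syllogism (𝐱 ⋀ᵗ 𝐜) 𝐲 (𝐜 ⇒ᵗ 𝐲 ⋀ᵗ 𝐜) ++
  ((𝐱 ⋀ᵗ 𝐜 ⇒ᵗ (𝐜 ⇒ᵗ 𝐲 ⋀ᵗ 𝐜)) ⇒ᵗ ((𝐱 ⋀ᵗ 𝐜 ⇒ᵗ 𝐜) ⇒ᵗ (𝐱 ⋀ᵗ 𝐜 ⇒ᵗ 𝐲 ⋀ᵗ 𝐜))) ∷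
  ((𝐱 ⋀ᵗ 𝐜 ⇒ᵗ 𝐜) ⇒ᵗ (𝐱 ⋀ᵗ 𝐜 ⇒ᵗ 𝐲 ⋀ᵗ 𝐜)) ∷ (𝐱 ⋀ᵗ 𝐜 ⇒ᵗ 𝐜) ∷ []
script ∧-right =                       -- C∧X → Y,  C∧X → (Y → C∧Y),  F10
  (𝐜 ⋀ᵗ 𝐱 ⇒ᵗ 𝐱) ∷ syllogism (𝐜 ⋀ᵗ 𝐱) 𝐱 𝐲 ++
  (𝐜 ⋀ᵗ 𝐱 ⇒ᵗ 𝐜) ∷ (𝐜 ⇒ᵗ (𝐲 ⇒ᵗ 𝐜 ⋀ᵗ 𝐲)) ∷ syllogism (𝐜 ⋀ᵗ 𝐱) 𝐜 (𝐲 ⇒ᵗ 𝐜 ⋀ᵗ 𝐲) ++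
  ((𝐜 ⋀ᵗ 𝐱 ⇒ᵗ (𝐲 ⇒ᵗ 𝐜 ⋀ᵗ 𝐲)) ⇒ᵗ ((𝐜 ⋀ᵗ 𝐱 ⇒ᵗ 𝐲) ⇒ᵗ (𝐜 ⋀ᵗ 𝐱 ⇒ᵗ 𝐜 ⋀ᵗ 𝐲))) ∷
  ((𝐜 ⋀ᵗ 𝐱 ⇒ᵗ 𝐲) ⇒ᵗ (𝐜 ⋀ᵗ 𝐱 ⇒ᵗ 𝐜 ⋀ᵗ 𝐲)) ∷ []

Admissible : List Template → Set
Admissible ts = length ts ≤ 15 × All (λ t → leaves t ≤ 16) ts

admissible? : ∀ ts → Dec (Admissible ts)
admissible? ts = (length ts ≤? 15) ×-dec all? (λ t → leaves t ≤? 16) ts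

admissible : ∀ f → Admissible (script f)
admissible ∨-left  = toWitness {a? = admissible? (script ∨-left)} _
admissible ∨-right = toWitness {a? = admissible? (script ∨-right)} _
admissible ∧-left  = toWitness {a? = admissible? (script ∧-left)} _
admissible ∧-right = toWitness {a? = admissible? (script ∧-right)} _

module _ {Γ : List Fm} where

  frameRule : ∀ f {ds} X Y C → IsDerivation Γ ds → (X ⇒ Y) ∈ ds →
              IsDerivation Γ ((ds ⊳⊳ inst (script f) X Y C) ⊳ (wrap f C X ⇒ wrap f C Y))
  frameRule ∨-left X Y C d x⇒y =
    let d₁ = axiom d (F4 Y C)
        d₂ = syllogismRule X Y (Y ⋁ C) d₁ (wk x⇒y) new      -- X → Y∨C
        d₃ = axiom d₂ (F5 Y C)
        d₄ = axiom d₃ (F11 X C (Y ⋁ C))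
        d₅ = modusPonens d₄ (wk (wk new)) new
    in  modusPonens d₅ (wk (wk new)) new
  frameRule ∨-right X Y C d x⇒y =
    let d₁ = axiom d (F5 C Y)
        d₂ = syllogismRule X Y (C ⋁ Y) d₁ (wk x⇒y) new      -- X → C∨Y
        d₃ = axiom d₂ (F4 C Y)
        d₄ = axiom d₃ (F11 C X (C ⋁ Y))
        d₅ = modusPonens d₄ (wk new) new
    in  modusPonens d₅ (wk (wk (wk new))) new
  frameRule ∧-left X Y C d x⇒y =
    let d₁ = axiom d (F2 X C)
        d₂ = syllogismRule (X ⋀ C) X Y d₁ new (wk x⇒y)      -- X∧C → Y
        d₃ = axiom d₂ (F1 Y C)
        d₄ = syllogismRule (X ⋀ C) Y (C ⇒ (Y ⋀ C)) d₃ (wk new) new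
        d₅ = axiom d₄ (F10 (X ⋀ C) C (Y ⋀ C))
        d₆ = modusPonens d₅ (wk new) new
        d₇ = axiom d₆ (F3 X C)
    in  modusPonens d₇ new (wk new)
  frameRule ∧-right X Y C d x⇒y =
    let d₁ = axiom d (F3 C X)
        d₂ = syllogismRule (C ⋀ X) X Y d₁ new (wk x⇒y)      -- C∧X → Y
        d₃ = axiom d₂ (F2 C X)
        d₄ = axiom d₃ (F1 C Y)
        d₅ = syllogismRule (C ⋀ X) C (Y ⇒ (C ⋀ Y)) d₄ (wk new) new
        d₆ = axiom d₅ (F10 (C ⋀ X) Y (C ⋀ Y))
        d₇ = modusPonens d₆ (wk new) new
        c∧x⇒y = wk (wk (wks (inst (syllogism 𝐱 𝐲 𝐜) (C ⋀ X) C (Y ⇒ (C ⋀ Y))) (wk (wk new))))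
    in  modusPonens d₇ c∧x⇒y new

record Chain (Γ : List Fm) (X Y : Fm) (m : ℕ) : Set where
  field
    steps      : List Fm
    derivation : IsDerivation Γ (steps ⊳ (X ⇒ Y))
    short      : length (steps ⊳ (X ⇒ Y)) ≤ 16 * m
    small      : All (λ φ → size φ ≤ 16 * size (X ⇒ Y)) (steps ⊳ (X ⇒ Y))

premissChain : ∀ {Γ X Y} → (X ⇒ Y) ∈ Γ → Chain Γ X Y 1
premissChain {X = X} {Y} p = record
  { steps = []
  ; derivation = [] ▷ inj₁ p
  ; short = s≤s z≤n
  ; small = m≤n*m (size (X ⇒ Y)) 16 ∷ [] }

-- Applying one frame: the script adds at most 15 formulae and the conclusion
-- one more, and all of them have size ≤ 16 · |wrap f C X → wrap f C Y|.
extend : ∀ {Γ X Y m m′} f C → Chain Γ X Y m → m < m′ →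
         Chain Γ (wrap f C X) (wrap f C Y) m′
extend {Γ} {X} {Y} {m} {m′} f C chain m<m′ = record
  { steps      = proved ⊳⊳ inst (script f) X Y C
  ; derivation = frameRule f X Y C derivation new
  ; short      = layerLength
  ; small      = All-⊳ (All-⊳⊳ oldSmall scriptSmall) (m≤n*m N′ 16) }
  where
  open Chain chain
  proved = steps ⊳ (X ⇒ Y)
  X′ = wrap f C X
  Y′ = wrap f C Y
  N′ = size (X′ ⇒ Y′)

  X≤X′ : size X ≤ size X′
  X≤X′ = proj₁ (wrap-grows f C X)

  Y≤Y′ : size Y ≤ size Y′
  Y≤Y′ = proj₁ (wrap-grows f C Y)

  C≤N′ : size C ≤ N′
  C≤N′ = ≤-trans (proj₂ (wrap-grows f C X)) (m≤m+n (size X′) (size Y′))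

  oldSmall : All (λ φ → size φ ≤ 16 * N′) proved
  oldSmall = All.map (λ p → ≤-trans p (*-monoʳ-≤ 16 (+-mono-≤ X≤X′ Y≤Y′))) small

  scriptSmall : All (λ φ → size φ ≤ 16 * N′) (inst (script f) X Y C)
  scriptSmall = size-inst (script f) (proj₂ (admissible f))
    (≤-trans X≤X′ (m≤m+n (size X′) (size Y′))) (≤-trans Y≤Y′ (m≤n+m (size Y′) (size X′))) C≤N′

  layerLength : length ((proved ⊳⊳ inst (script f) X Y C) ⊳ (X′ ⇒ Y′)) ≤ 16 * m′
  layerLength = begin
    length ((proved ⊳⊳ inst (script f) X Y C) ⊳ (X′ ⇒ Y′))
      ≡⟨ length-++ (proved ⊳⊳ inst (script f) X Y C) ⟩
    length (proved ⊳⊳ inst (script f) X Y C) + 1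
      ≡⟨ cong (_+ 1) (length-⊳⊳ proved (inst (script f) X Y C)) ⟩
    length proved + length (inst (script f) X Y C) + 1
      ≡⟨ cong (λ k → length proved + k + 1) (length-map _ (script f)) ⟩
    length proved + length (script f) + 1
      ≤⟨ +-monoˡ-≤ 1 (+-mono-≤ short (proj₁ (admissible f))) ⟩
    16 * m + 15 + 1
      ≡⟨ +-assoc (16 * m) 15 1 ⟩
    16 * m + 16
      ≡⟨ +-comm (16 * m) 16 ⟩
    16 + 16 * m
      ≡⟨ *-suc 16 m ⟨
    16 * suc m
      ≤⟨ *-monoʳ-≤ 16 m<m′ ⟩
    16 * m′ ∎
    where open ≤-Reasoning

dsize-≤ : ∀ {B} ds → All (λ φ → size φ ≤ B) ds → dsize ds ≤ length ds * B
dsize-≤ []       []       = z≤n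
dsize-≤ (φ ∷ ds) (p ∷ ps) = +-mono-≤ p (dsize-≤ ds ps)

quadraticSize : ∀ {ds m n} → length ds ≤ 16 * m → All (λ φ → size φ ≤ 16 * n) ds →
                m ≤ n → dsize ds ≤ 256 * (n * n)
quadraticSize {ds} {m} {n} short small m≤n = begin
  dsize ds                ≤⟨ dsize-≤ ds small ⟩
  length ds * (16 * n)    ≤⟨ *-monoˡ-≤ (16 * n) (≤-trans short (*-monoʳ-≤ 16 m≤n)) ⟩
  16 * n * (16 * n)       ≡⟨ square n ⟩
  256 * (n * n)           ∎
  where
  open ≤-Reasoning
  square : ∀ n → 16 * n * (16 * n) ≡ 256 * (n * n)
  square = solve-∀

size-tr : ∀ γ → size (tr γ) ≡ ∣ γ ∣
size-tr 𝕗         = refl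
size-tr 𝕥         = refl
size-tr (atom _)  = refl
size-tr (natom _) = refl
size-tr (var _)   = refl
size-tr (nvar _)  = refl
size-tr (γ ∨ δ)   = cong₂ _+_ (size-tr γ) (size-tr δ)
size-tr (γ ∧ δ)   = cong₂ _+_ (size-tr γ) (size-tr δ)

size-pos : ∀ γ → 0 < ∣ γ ∣
size-pos 𝕗         = s≤s z≤n
size-pos 𝕥         = s≤s z≤n
size-pos (atom _)  = s≤s z≤n
size-pos (natom _) = s≤s z≤n
size-pos (var _)   = s≤s z≤n
size-pos (nvar _)  = s≤s z≤n
size-pos (γ ∨ δ)   = ≤-trans (size-pos γ) (m≤m+n ∣ γ ∣ ∣ δ ∣)
size-pos (γ ∧ δ)   = ≤-trans (size-pos γ) (m≤m+n ∣ γ ∣ ∣ δ ∣)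

plug-mono : ∀ ξ {γ δ} → ∣ γ ∣ ≤ ∣ δ ∣ → ∣ ξ ⟦ γ ⟧ ∣ ≤ ∣ ξ ⟦ δ ⟧ ∣
plug-mono hole     p = p
plug-mono (ξ ∨ₗ C) p = +-monoˡ-≤ ∣ C ∣ (plug-mono ξ p)
plug-mono (C ∨ᵣ ξ) p = +-monoʳ-≤ ∣ C ∣ (plug-mono ξ p)
plug-mono (ξ ∧ₗ C) p = +-monoˡ-≤ ∣ C ∣ (plug-mono ξ p)
plug-mono (C ∧ᵣ ξ) p = +-monoʳ-≤ ∣ C ∣ (plug-mono ξ p)

context≤implication : ∀ ξ α β → ∣ ξ ⟦ atom 0 ⟧ ∣ ≤ size (tr (ξ ⟦ α ⟧) ⇒ tr (ξ ⟦ β ⟧))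
context≤implication ξ α β = begin
  ∣ ξ ⟦ atom 0 ⟧ ∣                            ≤⟨ plug-mono ξ (size-pos α) ⟩
  ∣ ξ ⟦ α ⟧ ∣                                 ≡⟨ size-tr (ξ ⟦ α ⟧) ⟨
  size (tr (ξ ⟦ α ⟧))                         ≤⟨ m≤m+n _ _ ⟩
  size (tr (ξ ⟦ α ⟧) ⇒ tr (ξ ⟦ β ⟧))          ∎
  where open ≤-Reasoning

-- The layered derivation for a whole context, by recursion on ξ: every
-- connective of ξ is a frame and costs at least one symbol of ξ{a}.
contextChain : ∀ α β ξ → Chain [ tr α ⇒ tr β ] (tr (ξ ⟦ α ⟧)) (tr (ξ ⟦ β ⟧)) ∣ ξ ⟦ atom 0 ⟧ ∣
contextChain α β hole     = premissChain (here refl)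
contextChain α β (ξ ∨ₗ C) = extend ∨-left  (tr C) (contextChain α β ξ) (m<m+n _ (size-pos C))
contextChain α β (C ∨ᵣ ξ) = extend ∨-right (tr C) (contextChain α β ξ) (m<n+m _ (size-pos C))
contextChain α β (ξ ∧ₗ C) = extend ∧-left  (tr C) (contextChain α β ξ) (m<m+n _ (size-pos C))
contextChain α β (C ∧ᵣ ξ) = extend ∧-right (tr C) (contextChain α β ξ) (m<n+m _ (size-pos C))

lemma4p8 : Σ ℕ λ c → Σ ℕ λ d → (ξ : Ctx) (α β : CoS) →
    Σ (List Fm) λ ds →
      IsDerivation [ tr α ⇒ tr β ] (ds ++ [ tr (ξ ⟦ α ⟧) ⇒ tr (ξ ⟦ β ⟧) ])
      × length (ds ++ [ tr (ξ ⟦ α ⟧) ⇒ tr (ξ ⟦ β ⟧) ]) ≤ c * suc ∣ ξ ∣ᶜ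
      × dsize (ds ++ [ tr (ξ ⟦ α ⟧) ⇒ tr (ξ ⟦ β ⟧) ])
          ≤ d * (size (tr (ξ ⟦ α ⟧) ⇒ tr (ξ ⟦ β ⟧))
                 * size (tr (ξ ⟦ α ⟧) ⇒ tr (ξ ⟦ β ⟧)))
lemma4p8 = 16 , 256 , λ ξ α β →
  let open Chain (contextChain α β ξ)
      -- |ξ{a}| = suc |ξ{ }|, as ξ{a} is nonempty
      m+1≡ = suc-pred ∣ ξ ⟦ atom 0 ⟧ ∣ {{>-nonZero (size-pos (ξ ⟦ atom 0 ⟧))}}
  in  steps
    , derivation
    , ≤-trans short (≤-reflexive (cong (16 *_) (sym m+1≡)))
    , quadraticSize short small (context≤implication ξ α β)
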